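{- Let $m\ge 3$ be an odd integer and let $n=2m^2$. Let $\Gamma$ be a strongly regular $n$-bicirculant with parameters $(4m^2,\,2m^2+m,\,m^2+m,\,m^2+m)$ which, for some $(2,n)$-semiregular automorphism $\rho$ and vertices $u,w$ in its two distinct orbits, has symbol $[S,S',T]$ with $|T|=m^2$ and $|S|=|S'|=m^2+m$. Then $\Gamma$ is not locally $3$-isoregular at any vertex.
   Context: All graphs are finite and simple. A strongly regular graph with parameters $(N,k,\lambda,\mu)$ is a $k$-regular graph on $N$ vertices in which adjacent vertices have exactly $\lambda$ common neighbours and distinct non-adjacent vertices have exactly $\mu$ common neighbours. An $n$-bicirculant is a graph on $2n$ vertices admitting a $(2,n)$-semiregular automorphism $\rho$, i.e. an automorphism whose cycle decomposition consists of exactly two cycles (orbits) $U,W$ of length $n$. For $u\in U$, $w\in W$, the symbol of $\Gamma$ relative to $(\rho,u,w)$ is $[S,S',T]$ where $S=\{s\in\mathbb{Z}_n\setminus\{0\}: u\sim\rho^s(u)\}$, $S'=\{r\in\mathbb{Z}_n\setminus\{0\}: w\sim\rho^r(w)\}$ and $T=\{t\in\mathbb{Z}_n: u\sim\rho^t(w)\}$. For a vertex set $X$, the valency of $X$ is the number of vertices adjacent to every vertex of $X$. An ordered pair $(x,y)$ of distinct vertices is $3$-isoregular if for all vertices $z\ne x,y$ the valency of $\{x,y,z\}$ depends only on the isomorphism type of the subgraph induced on $\{x,y,z\}$. A graph is locally $3$-isoregular at a vertex $x$ if there exist a neighbour $y$ of $x$ and a non-neighbour $z\neq x$ of $x$ such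 that both $(x,y)$ and $(x,z)$ are $3$-isoregular. -}

module Defs where

open import Data.Nat using (ℕ; zero; suc; _+_; _<_)
open import Data.Bool using (Bool; true; false; _∧_; not; if_then_else_)
open import Data.Fin using (Fin; toℕ) renaming (zero to fzero; suc to fsuc)
open import Data.Fin.Permutation using (Permutation′; _⟨$⟩ʳ_)
open import Data.Product using (Σ; _×_; ∃; _,_)
open import Relation.Binary.PropositionalEquality using (_≡_; _≢_)
open import Relation.Nullary using (¬_)
open import Data.Nat using (_≡ᵇ_)

record Graph (N : ℕ) : Set where
  field
    adj     : Fin N → Fin N → Bool
    adj-sym : ∀ x y → adj x y ≡ adj y x
    irrefl  : ∀ x → adj x x ≡ false
open Graph public

Adj : ∀ {N} → Graph N → Fin N → Fin N → Set
Adj G x y = adj G x y ≡ true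

count : ∀ n → (Fin n → Bool) → ℕ
count zero    f = 0
count (suc n) f = (if f fzero then 1 else 0) + count n (λ i → f (fsuc i))

degree : ∀ {N} → Graph N → Fin N → ℕ
degree {N} G x = count N (λ v → adj G x v)

commonNbrs : ∀ {N} → Graph N → Fin N → Fin N → ℕ
commonNbrs {N} G x y = count N (λ v → adj G x v ∧ adj G y v)

record StronglyRegular {N : ℕ} (G : Graph N) (k l μ : ℕ) : Set where
  field
    regular  : ∀ x → degree G x ≡ k
    adjacent : ∀ x y → Adj G x y → commonNbrs G x y ≡ l
    nonadj   : ∀ x y → x ≢ y → ¬ (Adj G x y) → commonNbrs G x y ≡ μ

IsAutomorphism : ∀ {N} → Graph N → Permutation′ N → Set
IsAutomorphism {N} G ρ = ∀ x y → adj G (ρ ⟨$⟩ʳ x) (ρ ⟨$⟩ʳ y) ≡ adj G x y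

pow : ∀ {N} → Permutation′ N → ℕ → Fin N → Fin N
pow ρ zero    x = x
pow ρ (suc i) x = ρ ⟨$⟩ʳ (pow ρ i x)

-- (2,n)-semiregular on 2n vertices: every orbit has length exactly n
-- (hence there are exactly two orbits, each of length n)
Semiregular2 : ∀ n → Permutation′ (2 Data.Nat.* n) → Set
Semiregular2 n ρ =
  (∀ x → pow ρ n x ≡ x) × (∀ x i → 0 < i → i < n → pow ρ i x ≢ x)

DistinctOrbits : ∀ {N} → Permutation′ N → Fin N → Fin N → Set
DistinctOrbits ρ u w = ∀ i → pow ρ i u ≢ w

-- cardinalities of the symbol [S,S',T] relative to (ρ,u,w), indices in Z_n
isNonzero : ∀ {n} → Fin n → Bool
isNonzero i = not (toℕ i ≡ᵇ 0)

card-S : ∀ {N} n → Graph N → Permutation′ N → Fin N → ℕ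
card-S n G ρ u = count n (λ s → isNonzero s ∧ adj G u (pow ρ (toℕ s) u))

card-T : ∀ {N} n → Graph N → Permutation′ N → Fin N → Fin N → ℕ
card-T n G ρ u w = count n (λ t → adj G u (pow ρ (toℕ t) w))

valency3 : ∀ {N} → Graph N → Fin N → Fin N → Fin N → ℕ
valency3 {N} G x y z = count N (λ v → adj G x v ∧ adj G y v ∧ adj G z v)

triple : ∀ {N} → Fin N → Fin N → Fin N → Fin 3 → Fin N
triple x y z fzero = x
triple x y z (fsuc fzero) = y
triple x y z (fsuc (fsuc fzero)) = z

Iso3 : ∀ {N} → Graph N → (Fin N × Fin N × Fin N) → (Fin N × Fin N × Fin N) → Set
Iso3 G (x , y , z) (x' , y' , z') =
  Σ (Permutation′ 3) λ σ → ∀ i j →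
    adj G (triple x y z i) (triple x y z j) ≡ adj G (triple x' y' z' (σ ⟨$⟩ʳ i)) (triple x' y' z' (σ ⟨$⟩ʳ j))

Isoregular3 : ∀ {N} → Graph N → Fin N → Fin N → Set
Isoregular3 G x y =
  x ≢ y ×
  (∀ z z' → z ≢ x → z ≢ y → z' ≢ x → z' ≢ y →
     Iso3 G (x , y , z) (x , y , z') → valency3 G x y z ≡ valency3 G x y z')

LocallyIsoregular3 : ∀ {N} → Graph N → Fin N → Set
LocallyIsoregular3 G x =
  Σ _ λ y → Σ _ λ z → Adj G x y × z ≢ x × ¬ (Adj G x z) × Isoregular3 G x y × Isoregular3 G x z

-- Only strong regularity with λ = μ and one non-adjacent 3-isoregular pair (x, z) are used.  Sort
-- the vertices s ∉ {x, z} into four classes by their adjacency to x and to z; isoregularity makes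
-- the valency v(s) of {x, z, s} a constant c p q on the class of profile (p, q).  Counting the
-- paths t – s – w with w a common neighbour of x and z gives, because λ = μ,
--   ∑_{s ∼ t} v(s) = μ² + (k − μ)·[t ∼ x][t ∼ z],
-- while writing v as a bilinear function of [s ∼ x] and [s ∼ z], corrected at x and z, expresses
-- the same sum linearly in the four class valencies.  For m ≥ 3 every class is nonempty, and the
-- four resulting equations force (c₁₁ − c₁₀ − c₀₁ + c₀₀)² = m².  The root m gives 2c₀₀ = m(m + 2),
-- impossible for odd m; the root −m makes m² − m − 1 divide m, impossible for m ≥ 3.
module Submission where

open import Defs
open import Algebra.Properties.CommutativeSemigroup using (x∙yz≈y∙xz)
open import Data.Bool as Bool using (Bool; true; false; _∧_; if_then_else_)
open import Data.Bool.Properties using (∧-assoc; ∧-idem; ∧-identityʳ; ¬-not)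
open import Data.Empty using (⊥-elim)
open import Data.Fin using (Fin; zero; suc; _≟_; #_)
open import Data.Fin.Permutation as Permutation using (Permutation′; _⟨$⟩ʳ_)
open import Data.Fin.Properties using (any?)
open import Data.Integer using (ℤ; +_; 0ℤ; 1ℤ; ∣_∣)
import Data.Integer.Properties as ℤₚ
open import Data.Integer.Tactic.RingSolver using (solve-∀)
open import Data.Nat as ℕ using (ℕ; zero; suc; s≤s; z≤n)
open import Data.Nat.Divisibility using (_∣_; divides; ∣⇒≤; m%n≡0⇒n∣m)
open import Data.Nat.DivMod using (_%_; _/_; m≡m%n+[m/n]*n; m%n<n)
import Data.Nat.Properties as ℕₚ
open import Data.Product using (∃; _×_; _,_; proj₁; proj₂)
open import Data.Sum as Sum using (_⊎_; inj₁; inj₂; [_,_]′)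
open import Data.Vec using (Vec; _∷_; []; lookup)
open import Function using (_∘_; case_of_)
open import Relation.Binary.PropositionalEquality
open import Relation.Nullary using (¬_; does; yes; no; ¬?; _×-dec_)

open import Algebra.Properties.Semiring.Sum ℤₚ.+-*-semiring
  using (sum-syntax; sum-cong-≗; sum-replicate-zero; ∑-comm; ∑-distrib-+; *-distribˡ-sum)

-- ℤ's arithmetic operators are opened block by block: the theorem at the end is stated with ℕ's.

ι : Bool → ℤ
ι true  = 1ℤ
ι false = 0ℤ

δ : ∀ {n} → Fin n → Fin n → ℤ
δ i j = ι (does (i ≟ j))

count-cong : ∀ n {f g : Fin n → Bool} → (∀ i → f i ≡ g i) → count n f ≡ count n g
count-cong zero    f≗g = refl
count-cong (suc n) f≗g = cong₂ (λ b c → (if b then 1 else 0) ℕ.+ c) (f≗g zero) (count-cong n (f≗g ∘ suc))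

count-true : ∀ n → count n (λ _ → true) ≡ n
count-true zero    = refl
count-true (suc n) = cong suc (count-true n)

module _ where
  open import Data.Integer using (_+_; _*_)
  open ≡-Reasoning

  ι-∧ : ∀ p q → ι (p ∧ q) ≡ ι p * ι q
  ι-∧ true  q = sym (ℤₚ.*-identityˡ (ι q))
  ι-∧ false q = refl

  +count≡∑ι : ∀ n (f : Fin n → Bool) → + count n f ≡ ∑[ i < n ] ι (f i)
  +count≡∑ι zero    f = refl
  +count≡∑ι (suc n) f =
    trans (ℤₚ.pos-+ (if f zero then 1 else 0) _) (cong₂ _+_ (+indicator (f zero)) (+count≡∑ι n (f ∘ suc)))
    where
    +indicator : ∀ b → + (if b then 1 else 0) ≡ ι b
    +indicator true  = refl
    +indicator false = refl

  ∑-δ : ∀ {n} (w : Fin n → ℤ) t → ∑[ i < n ] (w i * δ i t) ≡ w t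
  ∑-δ {suc n} w zero = begin
    w zero * 1ℤ + ∑[ i < n ] (w (suc i) * 0ℤ)
      ≡⟨ cong₂ _+_ (ℤₚ.*-identityʳ (w zero)) (trans (sum-cong-≗ (ℤₚ.*-zeroʳ ∘ w ∘ suc)) (sum-replicate-zero n)) ⟩
    w zero + 0ℤ
      ≡⟨ ℤₚ.+-identityʳ (w zero) ⟩
    w zero ∎
  ∑-δ {suc n} w (suc t) = begin
    w zero * 0ℤ + ∑[ i < n ] (w (suc i) * δ i t)  ≡⟨ cong (_+ ∑[ i < n ] (w (suc i) * δ i t)) (ℤₚ.*-zeroʳ (w zero)) ⟩
    0ℤ + ∑[ i < n ] (w (suc i) * δ i t)           ≡⟨ ℤₚ.+-identityˡ _ ⟩
    ∑[ i < n ] (w (suc i) * δ i t)                ≡⟨ ∑-δ (w ∘ suc) t ⟩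
    w (suc t) ∎

  ∑-*-∑ : ∀ {m n} (w : Fin n → ℤ) (a : Fin m → ℤ) (f : Fin m → Fin n → ℤ) →
          ∑[ i < n ] (w i * ∑[ j < m ] (a j * f j i)) ≡ ∑[ j < m ] (a j * ∑[ i < n ] (w i * f j i))
  ∑-*-∑ {m} {n} w a f = begin
    ∑[ i < n ] (w i * ∑[ j < m ] (a j * f j i))
      ≡⟨ sum-cong-≗ (λ i → *-distribˡ-sum (w i) (λ j → a j * f j i)) ⟩
    ∑[ i < n ] ∑[ j < m ] (w i * (a j * f j i))
      ≡⟨ ∑-comm (λ i j → w i * (a j * f j i)) ⟩
    ∑[ j < m ] ∑[ i < n ] (w i * (a j * f j i))
      ≡⟨ sum-cong-≗ (λ j → sum-cong-≗ (λ i → x∙yz≈y∙xz ℤₚ.*-commutativeSemigroup (w i) (a j) (f j i))) ⟩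
    ∑[ j < m ] ∑[ i < n ] (a j * (w i * f j i))
      ≡⟨ sum-cong-≗ (λ j → sym (*-distribˡ-sum (a j) (λ i → w i * f j i))) ⟩
    ∑[ j < m ] (a j * ∑[ i < n ] (w i * f j i)) ∎

  ∑₆ : ∀ (a m : Vec ℤ 6) → ∑[ j < 6 ] (lookup a j * lookup m j) ≡
       lookup a (# 0) * lookup m (# 0) + lookup a (# 1) * lookup m (# 1) + lookup a (# 2) * lookup m (# 2) +
       lookup a (# 3) * lookup m (# 3) + lookup a (# 4) * lookup m (# 4) + lookup a (# 5) * lookup m (# 5)
  ∑₆ (a₀ ∷ a₁ ∷ a₂ ∷ a₃ ∷ a₄ ∷ a₅ ∷ []) (m₀ ∷ m₁ ∷ m₂ ∷ m₃ ∷ m₄ ∷ m₅ ∷ []) =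
    reassociate (a₀ * m₀) (a₁ * m₁) (a₂ * m₂) (a₃ * m₃) (a₄ * m₄) (a₅ * m₅)
    where
    reassociate : ∀ t₀ t₁ t₂ t₃ t₄ t₅ → t₀ + (t₁ + (t₂ + (t₃ + (t₄ + (t₅ + 0ℤ))))) ≡ t₀ + t₁ + t₂ + t₃ + t₄ + t₅
    reassociate = solve-∀

-- Double counting in graphs

module _ {N : ℕ} (G : Graph N) where
  open import Data.Integer using (_+_; _*_; _-_)
  open ≡-Reasoning

  adjι : Fin N → Fin N → ℤ
  adjι u v = ι (adj G u v)

  +commonNbrs≡∑ : ∀ u v → + commonNbrs G u v ≡ ∑[ s < N ] (adjι u s * adjι v s)
  +commonNbrs≡∑ u v = trans (+count≡∑ι N _) (sum-cong-≗ λ s → ι-∧ (adj G u s) (adj G v s))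

  +valency3≡∑ : ∀ u v t → + valency3 G u v t ≡ ∑[ s < N ] (ι (adj G u s ∧ adj G v s) * adjι t s)
  +valency3≡∑ u v t = trans (+count≡∑ι N _) (sum-cong-≗ λ s →
    trans (cong ι (sym (∧-assoc (adj G u s) (adj G v s) (adj G t s)))) (ι-∧ _ (adj G t s)))

  ∑-adj-valency3 : ∀ u v t →
    ∑[ s < N ] (adjι t s * + valency3 G u v s) ≡ ∑[ w < N ] (ι (adj G u w ∧ adj G v w) * + commonNbrs G t w)
  ∑-adj-valency3 u v t = begin
    ∑[ s < N ] (adjι t s * + valency3 G u v s)
      ≡⟨ sum-cong-≗ (λ s → cong (adjι t s *_) (+valency3≡∑ u v s)) ⟩
    ∑[ s < N ] (adjι t s * ∑[ w < N ] (common w * adjι s w))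
      ≡⟨ ∑-*-∑ (adjι t) common (λ w s → adjι s w) ⟩
    ∑[ w < N ] (common w * ∑[ s < N ] (adjι t s * adjι s w))
      ≡⟨ sum-cong-≗ (λ w → cong (common w *_) (sum-cong-≗ λ s → cong (λ b → adjι t s * ι b) (adj-sym G s w))) ⟩
    ∑[ w < N ] (common w * ∑[ s < N ] (adjι t s * adjι w s))
      ≡⟨ sum-cong-≗ (λ w → cong (common w *_) (sym (+commonNbrs≡∑ t w))) ⟩
    ∑[ w < N ] (common w * + commonNbrs G t w) ∎
    where
    common : Fin N → ℤ
    common w = ι (adj G u w ∧ adj G v w)

  module _ {k μ : ℕ} (srg : StronglyRegular G k μ μ) where
    open StronglyRegular srg

    commonNbrs-distinct : ∀ u v → u ≢ v → commonNbrs G u v ≡ μ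
    commonNbrs-distinct u v u≢v with adj G u v in uv
    ... | true  = adjacent u v uv
    ... | false = nonadj u v u≢v (λ u~v → case trans (sym uv) u~v of λ ())

    +commonNbrs : ∀ t v → + commonNbrs G t v ≡ + μ + (+ k - + μ) * δ v t
    +commonNbrs t v with v ≟ t
    ... | yes refl = begin
      + commonNbrs G t t           ≡⟨ cong +_ (trans (count-cong N (λ s → ∧-idem (adj G t s))) (regular t)) ⟩
      + k                          ≡⟨ recentre (+ k) (+ μ) ⟩
      + μ + (+ k - + μ) * 1ℤ       ∎
      where
      recentre : ∀ K U → K ≡ U + (K - U) * 1ℤ
      recentre = solve-∀
    ... | no v≢t = begin
      + commonNbrs G t v           ≡⟨ cong +_ (commonNbrs-distinct t v (v≢t ∘ sym)) ⟩
      + μ                          ≡⟨ pad (+ μ) (+ k - + μ) ⟩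
      + μ + (+ k - + μ) * 0ℤ       ∎
      where
      pad : ∀ U D → U ≡ U + D * 0ℤ
      pad = solve-∀

    ∑-*-commonNbrs : ∀ (f : Fin N → ℤ) t →
      ∑[ v < N ] (f v * + commonNbrs G t v) ≡ + μ * ∑[ v < N ] f v + (+ k - + μ) * f t
    ∑-*-commonNbrs f t = begin
      ∑[ v < N ] (f v * + commonNbrs G t v)
        ≡⟨ sum-cong-≗ (λ v → trans (cong (f v *_) (+commonNbrs t v)) (distribute (f v) (+ μ) (+ k - + μ) (δ v t))) ⟩
      ∑[ v < N ] (+ μ * f v + (+ k - + μ) * (f v * δ v t))
        ≡⟨ ∑-distrib-+ (λ v → + μ * f v) (λ v → (+ k - + μ) * (f v * δ v t)) ⟩
      ∑[ v < N ] (+ μ * f v) + ∑[ v < N ] ((+ k - + μ) * (f v * δ v t))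
        ≡⟨ cong₂ _+_ (sym (*-distribˡ-sum (+ μ) f)) (sym (*-distribˡ-sum (+ k - + μ) (λ v → f v * δ v t))) ⟩
      + μ * ∑[ v < N ] f v + (+ k - + μ) * ∑[ v < N ] (f v * δ v t)
        ≡⟨ cong (λ e → + μ * ∑[ v < N ] f v + (+ k - + μ) * e) (∑-δ f t) ⟩
      + μ * ∑[ v < N ] f v + (+ k - + μ) * f t ∎
      where
      distribute : ∀ a U D e → a * (U + D * e) ≡ U * a + D * (a * e)
      distribute = solve-∀

    ∑-adj-valency3-λ≡μ : ∀ u v t →
      ∑[ s < N ] (adjι t s * + valency3 G u v s) ≡ + μ * + commonNbrs G u v + (+ k - + μ) * ι (adj G u t ∧ adj G v t)
    ∑-adj-valency3-λ≡μ u v t =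
      trans (∑-adj-valency3 u v t)
        (trans (∑-*-commonNbrs _ t) (cong (λ n → + μ * n + (+ k - + μ) * ι (adj G u t ∧ adj G v t)) (sym (+count≡∑ι N _))))

-- Bilinear expansion over adjacency profiles

module _ where
  open import Data.Integer using (_+_; _*_; _-_)

  interaction : (Bool → Bool → ℤ) → ℤ
  interaction c = c true true - c true false - c false true + c false false

  -- On {0, 1}², c p q = c₀₀ + (c₁₀ − c₀₀)·p + (c₀₁ − c₀₀)·q + (interaction c)·p·q; the last two
  -- coordinates correct the values cx, cz taken at the two vertices x, z themselves.
  coefficients : (Bool → Bool → ℤ) → ℤ → ℤ → Vec ℤ 6
  coefficients c cx cz =
    c false false ∷ c true false - c false false ∷ c false true - c false false ∷ interaction c ∷
    cx - c false false ∷ cz - c false false ∷ []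

  -- The right-hand sides are the six-term sums of bilinear-expansion unfolded, as the solver needs them.
  bilinear-corners :
    let corrected = λ c₀₀ cx cz X Z v → v + (cx - c₀₀) * X + (cz - c₀₀) * Z
        expanded  = λ c₁₁ c₁₀ c₀₁ c₀₀ cx cz X Z u v → c₀₀ * 1ℤ + ((c₁₀ - c₀₀) * u + ((c₀₁ - c₀₀) * v +
                      ((c₁₁ - c₁₀ - c₀₁ + c₀₀) * (u * v) + ((cx - c₀₀) * X + ((cz - c₀₀) * Z + 0ℤ)))))
    in (∀ c₁₁ c₁₀ c₀₁ c₀₀ cx cz X Z → corrected c₀₀ cx cz X Z c₁₁ ≡ expanded c₁₁ c₁₀ c₀₁ c₀₀ cx cz X Z 1ℤ 1ℤ) ×
       (∀ c₁₁ c₁₀ c₀₁ c₀₀ cx cz X Z → corrected c₀₀ cx cz X Z c₁₀ ≡ expanded c₁₁ c₁₀ c₀₁ c₀₀ cx cz X Z 1ℤ 0ℤ) ×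
       (∀ c₁₁ c₁₀ c₀₁ c₀₀ cx cz X Z → corrected c₀₀ cx cz X Z c₀₁ ≡ expanded c₁₁ c₁₀ c₀₁ c₀₀ cx cz X Z 0ℤ 1ℤ) ×
       (∀ c₁₁ c₁₀ c₀₁ c₀₀ cx cz X Z → corrected c₀₀ cx cz X Z c₀₀ ≡ expanded c₁₁ c₁₀ c₀₁ c₀₀ cx cz X Z 0ℤ 0ℤ)
  bilinear-corners = solve-∀ , solve-∀ , solve-∀ , solve-∀

  bilinear-expansion : ∀ c p q cx cz X Z →
    c p q + (cx - c false false) * X + (cz - c false false) * Z ≡
    ∑[ j < 6 ] (lookup (coefficients c cx cz) j * lookup (1ℤ ∷ ι p ∷ ι q ∷ ι p * ι q ∷ X ∷ Z ∷ []) j)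
  bilinear-expansion c true  true  cx cz X Z =
    proj₁ bilinear-corners (c true true) (c true false) (c false true) (c false false) cx cz X Z
  bilinear-expansion c true  false cx cz X Z =
    proj₁ (proj₂ bilinear-corners) (c true true) (c true false) (c false true) (c false false) cx cz X Z
  bilinear-expansion c false true  cx cz X Z =
    proj₁ (proj₂ (proj₂ bilinear-corners)) (c true true) (c true false) (c false true) (c false false) cx cz X Z
  bilinear-expansion c false false cx cz X Z =
    proj₂ (proj₂ (proj₂ bilinear-corners)) (c true true) (c true false) (c false true) (c false false) cx cz X Z

  indicator : Bool → Bool → Bool → Bool → ℤ
  indicator p₀ q₀ p q = ι (does (p Bool.≟ p₀) ∧ does (q Bool.≟ q₀))

  indicator-elsewhere : ∀ {p₀ q₀ p q} → ¬ (p ≡ p₀ × q ≡ q₀) → indicator p₀ q₀ p q ≡ 0ℤ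
  indicator-elsewhere {p₀} {q₀} {p} {q} elsewhere with p Bool.≟ p₀ | q Bool.≟ q₀
  ... | yes p≡p₀ | yes q≡q₀ = ⊥-elim (elsewhere (p≡p₀ , q≡q₀))
  ... | yes _    | no _     = refl
  ... | no _     | _        = refl

  -- The number of vertices outside a non-adjacent pair {x, z} of an srg(N, k, μ, μ) whose adjacency
  -- to (x, z) is (p, q).
  profileCount : (N k μ : ℤ) → Bool → Bool → ℤ
  profileCount N k μ true  true  = μ
  profileCount N k μ true  false = k - μ
  profileCount N k μ false true  = k - μ
  profileCount N k μ false false = N - k - k + μ - + 2

  profileCount-corners :
    let e = λ N K U i₁₁ i₁₀ i₀₁ i₀₀ → i₀₀ * N + (i₁₀ - i₀₀) * K + (i₀₁ - i₀₀) * K +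
              (i₁₁ - i₁₀ - i₀₁ + i₀₀) * U + (0ℤ - i₀₀) * 1ℤ + (0ℤ - i₀₀) * 1ℤ
    in (∀ N K U → e N K U 1ℤ 0ℤ 0ℤ 0ℤ ≡ U) × (∀ N K U → e N K U 0ℤ 1ℤ 0ℤ 0ℤ ≡ K - U) ×
       (∀ N K U → e N K U 0ℤ 0ℤ 1ℤ 0ℤ ≡ K - U) × (∀ N K U → e N K U 0ℤ 0ℤ 0ℤ 1ℤ ≡ N - K - K + U - + 2)
  profileCount-corners = solve-∀ , solve-∀ , solve-∀ , solve-∀

  profileCount-expansion : ∀ N K U p₀ q₀ →
    ∑[ j < 6 ] (lookup (coefficients (indicator p₀ q₀) 0ℤ 0ℤ) j * lookup (N ∷ K ∷ K ∷ U ∷ 1ℤ ∷ 1ℤ ∷ []) j) ≡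
    profileCount N K U p₀ q₀
  profileCount-expansion N K U p₀ q₀ =
    trans (∑₆ (coefficients (indicator p₀ q₀) 0ℤ 0ℤ) (N ∷ K ∷ K ∷ U ∷ 1ℤ ∷ 1ℤ ∷ [])) (corner p₀ q₀)
    where
    corner : ∀ p₀ q₀ → let i = indicator p₀ q₀ in
      i false false * N + (i true false - i false false) * K + (i false true - i false false) * K +
      interaction i * U + (0ℤ - i false false) * 1ℤ + (0ℤ - i false false) * 1ℤ ≡ profileCount N K U p₀ q₀
    corner true  true  = proj₁ profileCount-corners N K U
    corner true  false = proj₁ (proj₂ profileCount-corners) N K U
    corner false true  = proj₁ (proj₂ (proj₂ profileCount-corners)) N K U
    corner false false = proj₂ (proj₂ (proj₂ profileCount-corners)) N K U

  -- ∑_{s ∼ t} v(s) evaluated in two ways at a vertex t of profile (p, q), where v(s) is the valency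
  -- of {x, z, s}, c p q its value on the class of profile (p, q), and v(x) = v(z) = μ.
  ValencyEquation : (k μ : ℤ) (c : Bool → Bool → ℤ) (p q : Bool) → Set
  ValencyEquation k μ c p q =
    μ * μ + (k - μ) * ι (p ∧ q) ≡
    c false false * k + (c true false - c false false) * μ + (c false true - c false false) * μ +
    interaction c * c p q + (μ - c false false) * ι p + (μ - c false false) * ι q

module NonadjacentPair {N : ℕ} (G : Graph N) {x z : Fin N} (x≢z : x ≢ z) (x≁z : adj G x z ≡ false) where
  open import Data.Integer using (_+_; _*_; _-_)
  open ≡-Reasoning

  z≁x : adj G z x ≡ false
  z≁x = trans (adj-sym G z x) x≁z

  HasProfile : Bool → Bool → Fin N → Set
  HasProfile p q s = s ≢ x × s ≢ z × adj G x s ≡ p × adj G z s ≡ q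

  same-profile⇒Iso3 : ∀ {s s'} → adj G x s ≡ adj G x s' → adj G z s ≡ adj G z s' → Iso3 G (x , z , s) (x , z , s')
  same-profile⇒Iso3 {s} {s'} xs≡xs' zs≡zs' = Permutation.id , preserved
    where
    preserved : ∀ i j → adj G (triple x z s i) (triple x z s j) ≡
                        adj G (triple x z s' (Permutation.id ⟨$⟩ʳ i)) (triple x z s' (Permutation.id ⟨$⟩ʳ j))
    preserved zero             zero             = refl
    preserved zero             (suc zero)       = refl
    preserved zero             (suc (suc zero)) = xs≡xs'
    preserved (suc zero)       zero             = refl
    preserved (suc zero)       (suc zero)       = refl
    preserved (suc zero)       (suc (suc zero)) = zs≡zs'
    preserved (suc (suc zero)) zero             = trans (adj-sym G s x) (trans xs≡xs' (adj-sym G x s'))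
    preserved (suc (suc zero)) (suc zero)       = trans (adj-sym G s z) (trans zs≡zs' (adj-sym G z s'))
    preserved (suc (suc zero)) (suc (suc zero)) = trans (irrefl G s) (sym (irrefl G s'))

  IsoregularPair : Set
  IsoregularPair = ∀ s s' → s ≢ x → s ≢ z → s' ≢ x → s' ≢ z →
                   Iso3 G (x , z , s) (x , z , s') → valency3 G x z s ≡ valency3 G x z s'

  IsClassFunction : (Fin N → ℤ) → (Bool → Bool → ℤ) → Set
  IsClassFunction F c = ∀ s → s ≢ x → s ≢ z → F s ≡ c (adj G x s) (adj G z s)

  basis : Vec (Fin N → ℤ) 6
  basis = (λ _ → 1ℤ) ∷ adjι G x ∷ adjι G z ∷ (λ s → adjι G x s * adjι G z s) ∷ (λ s → δ s x) ∷ (λ s → δ s z) ∷ []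

  class-expansion : ∀ {F c} → IsClassFunction F c → ∀ s →
    F s ≡ ∑[ j < 6 ] (lookup (coefficients c (F x) (F z)) j * lookup basis j s)
  class-expansion {F} {c} F-class s =
    trans (corrected s) (bilinear-expansion c (adj G x s) (adj G z s) (F x) (F z) (δ s x) (δ s z))
    where
    corrected : ∀ s → F s ≡ c (adj G x s) (adj G z s) + (F x - c false false) * δ s x + (F z - c false false) * δ s z
    corrected s with s ≟ x | s ≟ z
    ... | yes refl | yes x≡z = ⊥-elim (x≢z x≡z)
    ... | yes refl | no _ rewrite irrefl G x | z≁x = at-x (F x) (F z) (c false false)
      where
      at-x : ∀ a b d → a ≡ d + (a - d) * 1ℤ + (b - d) * 0ℤ
      at-x = solve-∀
    ... | no _ | yes refl rewrite x≁z | irrefl G z = at-z (F x) (F z) (c false false)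
      where
      at-z : ∀ a b d → b ≡ d + (a - d) * 0ℤ + (b - d) * 1ℤ
      at-z = solve-∀
    ... | no s≢x | no s≢z = trans (F-class s s≢x s≢z) (elsewhere (c (adj G x s) (adj G z s)) (F x - c false false) (F z - c false false))
      where
      elsewhere : ∀ v a b → v ≡ v + a * 0ℤ + b * 0ℤ
      elsewhere = solve-∀

  ∑-*-classFunction : ∀ {F c} → IsClassFunction F c → ∀ (w : Fin N → ℤ) →
    ∑[ s < N ] (w s * F s) ≡ ∑[ j < 6 ] (lookup (coefficients c (F x) (F z)) j * ∑[ s < N ] (w s * lookup basis j s))
  ∑-*-classFunction {F} {c} F-class w =
    trans (sum-cong-≗ (λ s → cong (w s *_) (class-expansion {F} {c} F-class s)))
          (∑-*-∑ w (lookup (coefficients c (F x) (F z))) (lookup basis))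

  module _ {k μ : ℕ} (srg : StronglyRegular G k μ μ) where
    open StronglyRegular srg

    commonNbrs-xz : commonNbrs G x z ≡ μ
    commonNbrs-xz = commonNbrs-distinct G srg x z x≢z

    counting-moments : ∀ j → ∑[ s < N ] (1ℤ * lookup basis j s) ≡ lookup (+ N ∷ + k ∷ + k ∷ + μ ∷ 1ℤ ∷ 1ℤ ∷ []) j
    counting-moments zero = trans (sym (+count≡∑ι N (λ _ → true))) (cong +_ (count-true N))
    counting-moments (suc zero) =
      trans (sum-cong-≗ (ℤₚ.*-identityˡ ∘ adjι G x)) (trans (sym (+count≡∑ι N (adj G x))) (cong +_ (regular x)))
    counting-moments (suc (suc zero)) =
      trans (sum-cong-≗ (ℤₚ.*-identityˡ ∘ adjι G z)) (trans (sym (+count≡∑ι N (adj G z))) (cong +_ (regular z)))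
    counting-moments (suc (suc (suc zero))) =
      trans (sum-cong-≗ (λ s → ℤₚ.*-identityˡ (adjι G x s * adjι G z s))) (trans (sym (+commonNbrs≡∑ G x z)) (cong +_ commonNbrs-xz))
    counting-moments (suc (suc (suc (suc zero)))) = ∑-δ (λ _ → 1ℤ) x
    counting-moments (suc (suc (suc (suc (suc zero))))) = ∑-δ (λ _ → 1ℤ) z

    -- If no vertex has profile (p, q), the zero function is a class function for the indicator of
    -- (p, q), and expanding it with unit weights evaluates profileCount to 0.
    representative : ∀ p q → profileCount (+ N) (+ k) (+ μ) p q ≢ 0ℤ → ∃ (HasProfile p q)
    representative p q nonempty
      with any? (λ s → ¬? (s ≟ x) ×-dec ¬? (s ≟ z) ×-dec adj G x s Bool.≟ p ×-dec adj G z s Bool.≟ q)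
    ... | yes found = found
    ... | no none = ⊥-elim (nonempty (begin
      profileCount (+ N) (+ k) (+ μ) p q
        ≡⟨ sym (profileCount-expansion (+ N) (+ k) (+ μ) p q) ⟩
      ∑[ j < 6 ] (lookup (coefficients (indicator p q) 0ℤ 0ℤ) j * lookup (+ N ∷ + k ∷ + k ∷ + μ ∷ 1ℤ ∷ 1ℤ ∷ []) j)
        ≡⟨ sum-cong-≗ (λ j → cong (lookup (coefficients (indicator p q) 0ℤ 0ℤ) j *_) (sym (counting-moments j))) ⟩
      ∑[ j < 6 ] (lookup (coefficients (indicator p q) 0ℤ 0ℤ) j * ∑[ s < N ] (1ℤ * lookup basis j s))
        ≡⟨ sym (∑-*-classFunction {λ _ → 0ℤ} {indicator p q} zero-is-class (λ _ → 1ℤ)) ⟩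
      ∑[ s < N ] (1ℤ * 0ℤ)
        ≡⟨ sum-replicate-zero N ⟩
      0ℤ ∎))
      where
      zero-is-class : IsClassFunction (λ _ → 0ℤ) (indicator p q)
      zero-is-class s s≢x s≢z =
        sym (indicator-elsewhere (λ (xs≡p , zs≡q) → none (s , s≢x , s≢z , xs≡p , zs≡q)))

    module Valencies (isoregular : IsoregularPair) (rep : ∀ p q → ∃ (HasProfile p q)) where

      valency : Fin N → ℤ
      valency s = + valency3 G x z s

      classValency : Bool → Bool → ℤ
      classValency p q = valency (proj₁ (rep p q))

      valency-isClass : IsClassFunction valency classValency
      valency-isClass s s≢x s≢z =
        let (t , t≢x , t≢z , xt , zt) = rep (adj G x s) (adj G z s)
        in cong +_ (isoregular s t s≢x s≢z t≢x t≢z (same-profile⇒Iso3 (sym xt) (sym zt)))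

      valency-x : valency x ≡ + μ
      valency-x = cong +_ (trans (count-cong N (λ v → absorb (adj G x v) (adj G z v))) commonNbrs-xz)
        where
        absorb : ∀ a b → a ∧ b ∧ a ≡ a ∧ b
        absorb true  b = ∧-identityʳ b
        absorb false b = refl

      valency-z : valency z ≡ + μ
      valency-z = cong +_ (trans (count-cong N (λ v → cong (adj G x v ∧_) (∧-idem (adj G z v)))) commonNbrs-xz)

      adjacency-moments : ∀ {p q t} → HasProfile p q t → ∀ j →
        ∑[ s < N ] (adjι G t s * lookup basis j s) ≡ lookup (+ k ∷ + μ ∷ + μ ∷ valency t ∷ ι p ∷ ι q ∷ []) j
      adjacency-moments {t = t} _ zero =
        trans (sum-cong-≗ (ℤₚ.*-identityʳ ∘ adjι G t)) (trans (sym (+count≡∑ι N (adj G t))) (cong +_ (regular t)))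
      adjacency-moments {t = t} (t≢x , _) (suc zero) =
        trans (sym (+commonNbrs≡∑ G t x)) (cong +_ (commonNbrs-distinct G srg t x t≢x))
      adjacency-moments {t = t} (_ , t≢z , _) (suc (suc zero)) =
        trans (sym (+commonNbrs≡∑ G t z)) (cong +_ (commonNbrs-distinct G srg t z t≢z))
      adjacency-moments {t = t} _ (suc (suc (suc zero))) =
        trans (sum-cong-≗ λ s → trans (ℤₚ.*-comm (adjι G t s) _) (cong (_* adjι G t s) (sym (ι-∧ (adj G x s) (adj G z s)))))
              (sym (+valency3≡∑ G x z t))
      adjacency-moments {t = t} (_ , _ , xt , _) (suc (suc (suc (suc zero)))) =
        trans (∑-δ (adjι G t) x) (cong ι (trans (adj-sym G t x) xt))
      adjacency-moments {t = t} (_ , _ , _ , zt) (suc (suc (suc (suc (suc zero))))) =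
        trans (∑-δ (adjι G t) z) (cong ι (trans (adj-sym G t z) zt))

      valency-equation : ∀ p q → ValencyEquation (+ k) (+ μ) classValency p q
      valency-equation p q = trans (begin
        + μ * + μ + (+ k - + μ) * ι (p ∧ q)
          ≡⟨ cong₂ (λ n b → + μ * + n + (+ k - + μ) * ι b) (sym commonNbrs-xz) (sym (cong₂ _∧_ xt zt)) ⟩
        + μ * + commonNbrs G x z + (+ k - + μ) * ι (adj G x t ∧ adj G z t)
          ≡⟨ sym (∑-adj-valency3-λ≡μ G srg x z t) ⟩
        ∑[ s < N ] (adjι G t s * valency s)
          ≡⟨ ∑-*-classFunction {valency} {classValency} valency-isClass (adjι G t) ⟩
        ∑[ j < 6 ] (lookup (coefficients classValency (valency x) (valency z)) j * ∑[ s < N ] (adjι G t s * lookup basis j s))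
          ≡⟨ sum-cong-≗ (λ j → cong₂ _*_ (cong₂ (λ a b → lookup (coefficients classValency a b) j) valency-x valency-z)
                                          (adjacency-moments t-profile j)) ⟩
        ∑[ j < 6 ] (lookup (coefficients classValency (+ μ) (+ μ)) j * lookup moments j) ∎)
        (∑₆ (coefficients classValency (+ μ) (+ μ)) moments)
        where
        t : Fin N
        t = proj₁ (rep p q)
        t-profile : HasProfile p q t
        t-profile = proj₂ (rep p q)
        xt : adj G x t ≡ p
        xt = proj₁ (proj₂ (proj₂ t-profile))
        zt : adj G z t ≡ q
        zt = proj₂ (proj₂ (proj₂ t-profile))
        moments : Vec ℤ 6
        moments = + k ∷ + μ ∷ + μ ∷ classValency p q ∷ ι p ∷ ι q ∷ []

    valency-equations : IsoregularPair → (∀ p q → profileCount (+ N) (+ k) (+ μ) p q ≢ 0ℤ) →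
      ∃ λ c → ∀ p q → ValencyEquation (+ k) (+ μ) c p q
    valency-equations isoregular nonempty = classValency , valency-equation
      where
      open Valencies isoregular (λ p q → representative p q (nonempty p q))

-- The valency equations have no solution

module _ where
  open import Data.Integer using (_+_; _*_; _-_; -_)

  combination-of-zeros : ∀ {r₁ r₂ r₃ r₄ : ℤ} a₁ a₂ a₃ a₄ → r₁ ≡ 0ℤ → r₂ ≡ 0ℤ → r₃ ≡ 0ℤ → r₄ ≡ 0ℤ →
                         a₁ * r₁ + a₂ * r₂ + a₃ * r₃ + a₄ * r₄ ≡ 0ℤ
  combination-of-zeros a₁ a₂ a₃ a₄ refl refl refl refl = vanish a₁ a₂ a₃ a₄
    where
    vanish : ∀ a₁ a₂ a₃ a₄ → a₁ * 0ℤ + a₂ * 0ℤ + a₃ * 0ℤ + a₄ * 0ℤ ≡ 0ℤ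
    vanish = solve-∀

  -- r M c₁₁ c₁₀ c₀₁ c₀₀ p q v is the residual of ValencyEquation at profile (p, q); each identity
  -- writes its left side as a combination of residuals and of interaction ∓ M.
  valency-identities :
    let μ = λ M → M * M + M
        k = λ M → M * M + M + M * M
        Δ = λ c₁₁ c₁₀ c₀₁ c₀₀ → c₁₁ - c₁₀ - c₀₁ + c₀₀
        r = λ M c₁₁ c₁₀ c₀₁ c₀₀ p q v →
              μ M * μ M + (k M - μ M) * ι (p ∧ q) -
              (c₀₀ * k M + (c₁₀ - c₀₀) * μ M + (c₀₁ - c₀₀) * μ M + Δ c₁₁ c₁₀ c₀₁ c₀₀ * v + (μ M - c₀₀) * ι p + (μ M - c₀₀) * ι q)
    in (∀ M c₁₁ c₁₀ c₀₁ c₀₀ →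
          (Δ c₁₁ c₁₀ c₀₁ c₀₀ - M) * (Δ c₁₁ c₁₀ c₀₁ c₀₀ + M) ≡
          1ℤ * r M c₁₁ c₁₀ c₀₁ c₀₀ true false c₁₀ + 1ℤ * r M c₁₁ c₁₀ c₀₁ c₀₀ false true c₀₁ +
          (- 1ℤ) * r M c₁₁ c₁₀ c₀₁ c₀₀ false false c₀₀ + (- 1ℤ) * r M c₁₁ c₁₀ c₀₁ c₀₀ true true c₁₁) ×
       (∀ M c₁₁ c₁₀ c₀₁ c₀₀ →
          (1ℤ + M) * (1ℤ + M) * (+ 2 * c₀₀ - M * (M + + 2)) ≡
          (- (+ 2 * M + + 3)) * r M c₁₁ c₁₀ c₀₁ c₀₀ false false c₀₀ + (1ℤ + M) * r M c₁₁ c₁₀ c₀₁ c₀₀ true false c₁₀ +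
          (1ℤ + M) * r M c₁₁ c₁₀ c₀₁ c₀₀ false true c₀₁ +
          ((1ℤ + M) * (c₁₀ + c₀₁) - (+ 2 * M + + 3) * c₀₀) * (Δ c₁₁ c₁₀ c₀₁ c₀₀ - M)) ×
       (∀ M c₁₁ c₁₀ c₀₁ c₀₀ →
          M * ((M * M - M - 1ℤ) * (c₁₀ + c₀₁ - M * M - + 2 * M) + M) ≡
          (M + 1ℤ) * r M c₁₁ c₁₀ c₀₁ c₀₀ false false c₀₀ + (- M) * r M c₁₁ c₁₀ c₀₁ c₀₀ true false c₁₀ +
          (- M) * r M c₁₁ c₁₀ c₀₁ c₀₀ false true c₀₁ +
          ((M + 1ℤ) * c₀₀ - M * (c₁₀ + c₀₁)) * (Δ c₁₁ c₁₀ c₀₁ c₀₀ + M))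
  valency-identities = solve-∀ , solve-∀ , solve-∀

  i*j≡0⇒j≡0 : ∀ i j → i ≢ 0ℤ → i * j ≡ 0ℤ → j ≡ 0ℤ
  i*j≡0⇒j≡0 i j i≢0 ij≡0 with ℤₚ.i*j≡0⇒i≡0∨j≡0 i {j} ij≡0
  ... | inj₁ i≡0 = ⊥-elim (i≢0 i≡0)
  ... | inj₂ j≡0 = j≡0

  module _ (M : ℤ) (c : Bool → Bool → ℤ)
           (equation : ∀ p q → ValencyEquation (M * M + M + M * M) (M * M + M) c p q) where

    interaction-squared : (interaction c - M) * (interaction c + M) ≡ 0ℤ
    interaction-squared =
      trans (proj₁ valency-identities M (c true true) (c true false) (c false true) (c false false))
            (combination-of-zeros 1ℤ 1ℤ (- 1ℤ) (- 1ℤ)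
              (ℤₚ.i≡j⇒i-j≡0 (equation true false)) (ℤₚ.i≡j⇒i-j≡0 (equation false true))
              (ℤₚ.i≡j⇒i-j≡0 (equation false false)) (ℤₚ.i≡j⇒i-j≡0 (equation true true)))

    interaction≡M⇒parity : 1ℤ + M ≢ 0ℤ → interaction c - M ≡ 0ℤ → + 2 * c false false - M * (M + + 2) ≡ 0ℤ
    interaction≡M⇒parity 1+M≢0 interaction-M≡0 =
      i*j≡0⇒j≡0 ((1ℤ + M) * (1ℤ + M)) (+ 2 * c false false - M * (M + + 2))
        (λ square≡0 → 1+M≢0 (i*j≡0⇒j≡0 (1ℤ + M) (1ℤ + M) 1+M≢0 square≡0))
        (trans (proj₁ (proj₂ valency-identities) M (c true true) (c true false) (c false true) (c false false))
               (combination-of-zeros (- (+ 2 * M + + 3)) (1ℤ + M) (1ℤ + M)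
                 ((1ℤ + M) * (c true false + c false true) - (+ 2 * M + + 3) * c false false)
                 (ℤₚ.i≡j⇒i-j≡0 (equation false false)) (ℤₚ.i≡j⇒i-j≡0 (equation true false))
                 (ℤₚ.i≡j⇒i-j≡0 (equation false true)) interaction-M≡0))

    interaction≡-M⇒divisibility : M ≢ 0ℤ → interaction c + M ≡ 0ℤ →
      (M * M - M - 1ℤ) * (c true false + c false true - M * M - + 2 * M) + M ≡ 0ℤ
    interaction≡-M⇒divisibility M≢0 interaction+M≡0 =
      i*j≡0⇒j≡0 M ((M * M - M - 1ℤ) * (c true false + c false true - M * M - + 2 * M) + M) M≢0
        (trans (proj₂ (proj₂ valency-identities) M (c true true) (c true false) (c false true) (c false false))
               (combination-of-zeros (M + 1ℤ) (- M) (- M) ((M + 1ℤ) * c false false - M * (c true false + c false true))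
                 (ℤₚ.i≡j⇒i-j≡0 (equation false false)) (ℤₚ.i≡j⇒i-j≡0 (equation true false))
                 (ℤₚ.i≡j⇒i-j≡0 (equation false true)) interaction+M≡0))

    valency-dichotomy : M ≢ 0ℤ → 1ℤ + M ≢ 0ℤ →
      (+ 2 * c false false - M * (M + + 2) ≡ 0ℤ) ⊎
      ((M * M - M - 1ℤ) * (c true false + c false true - M * M - + 2 * M) + M ≡ 0ℤ)
    valency-dichotomy M≢0 1+M≢0 =
      Sum.map (interaction≡M⇒parity 1+M≢0) (interaction≡-M⇒divisibility M≢0)
              (ℤₚ.i*j≡0⇒i≡0∨j≡0 (interaction c - M) interaction-squared)

-- Arithmetic of odd m ≥ 3

odd⇒suc-even : ∀ m → ¬ 2 ∣ m → ∃ λ r → m ≡ suc (r ℕ.* 2)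
odd⇒suc-even m m-odd with m % 2 in m%2 | m%n<n m 2
... | 0 | _ = ⊥-elim (m-odd (m%n≡0⇒n∣m m 2 m%2))
... | 1 | _ = m / 2 , trans (m≡m%n+[m/n]*n m 2) (cong (ℕ._+ m / 2 ℕ.* 2) m%2)
... | suc (suc _) | s≤s (s≤s ())

module _ where
  open import Data.Integer using (_+_; _*_; _-_; -_)
  open ≡-Reasoning

  2y≢1 : ∀ y → + 2 * y ≢ 1ℤ
  2y≢1 y 2y≡1 = ℕₚ.even≢odd ∣ y ∣ 0 (trans (sym (ℤₚ.abs-* (+ 2) y)) (cong ∣_∣ 2y≡1))

  odd⇒2y-m[m+2]≢0 : ∀ m → ¬ 2 ∣ m → ∀ y → + 2 * y - + m * (+ m + + 2) ≢ 0ℤ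
  odd⇒2y-m[m+2]≢0 m m-odd y with odd⇒suc-even m m-odd
  ... | r , refl = λ gap≡0 → 2y≢1 (y - (+ 2 * R * R + + 4 * R + 1ℤ))
          (ℤₚ.i-j≡0⇒i≡j _ _ (trans (sym (regroup y R)) (subst (λ M → + 2 * y - M * (M + + 2) ≡ 0ℤ) +m≡1+R*2 gap≡0)))
    where
    R : ℤ
    R = + r
    +m≡1+R*2 : + suc (r ℕ.* 2) ≡ 1ℤ + R * + 2
    +m≡1+R*2 = trans (ℤₚ.pos-+ 1 (r ℕ.* 2)) (cong (λ t → 1ℤ + t) (ℤₚ.pos-* r 2))
    regroup : ∀ y R → + 2 * y - (1ℤ + R * + 2) * (1ℤ + R * + 2 + + 2) ≡ + 2 * (y - (+ 2 * R * R + + 4 * R + 1ℤ)) - 1ℤ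
    regroup = solve-∀

  -- (3 + s)² − (3 + s) − 1 = (3 + s) + (2 + s(4 + s)) would be a divisor of 3 + s exceeding it.
  [m²-m-1]y+m≢0 : ∀ s Y → let M = + (3 ℕ.+ s) in (M * M - M - 1ℤ) * Y + M ≢ 0ℤ
  [m²-m-1]y+m≢0 s Y AY+M≡0 = ℕₚ.m+1+n≰m (3 ℕ.+ s) (∣⇒≤ (divides ∣ Y ∣ product))
    where
    M A : ℤ
    M = + (3 ℕ.+ s)
    A = M * M - M - 1ℤ
    A≡ : A ≡ + ((3 ℕ.+ s) ℕ.+ (2 ℕ.+ s ℕ.* (4 ℕ.+ s)))
    A≡ = trans (expand (+ s)) (cong (λ t → M + (+ 2 + t)) (sym (ℤₚ.pos-* s (4 ℕ.+ s))))
      where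
      expand : ∀ S → (+ 3 + S) * (+ 3 + S) - (+ 3 + S) - 1ℤ ≡ (+ 3 + S) + (+ 2 + S * (+ 4 + S))
      expand = solve-∀
    AY≡-M : A * Y ≡ 0ℤ - M
    AY≡-M = trans (shift (A * Y) M) (cong (_- M) AY+M≡0)
      where
      shift : ∀ a b → a ≡ (a + b) - b
      shift = solve-∀
    product : 3 ℕ.+ s ≡ ∣ Y ∣ ℕ.* ((3 ℕ.+ s) ℕ.+ (2 ℕ.+ s ℕ.* (4 ℕ.+ s)))
    product = begin
      3 ℕ.+ s                ≡⟨ cong ∣_∣ (sym AY≡-M) ⟩
      ∣ A * Y ∣              ≡⟨ ℤₚ.abs-* A Y ⟩
      ∣ A ∣ ℕ.* ∣ Y ∣        ≡⟨ cong (λ a → ∣ a ∣ ℕ.* ∣ Y ∣) A≡ ⟩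
      ((3 ℕ.+ s) ℕ.+ (2 ℕ.+ s ℕ.* (4 ℕ.+ s))) ℕ.* ∣ Y ∣ ≡⟨ ℕₚ.*-comm _ ∣ Y ∣ ⟩
      ∣ Y ∣ ℕ.* ((3 ℕ.+ s) ℕ.+ (2 ℕ.+ s ℕ.* (4 ℕ.+ s))) ∎

  module Parameters (m : ℕ) where
    M : ℤ
    M = + m

    +m²≡ : + (m ℕ.^ 2) ≡ M * M
    +m²≡ = trans (ℤₚ.pos-* m (m ℕ.* 1)) (cong (M *_) (cong +_ (ℕₚ.*-identityʳ m)))

    +μ≡ : + (m ℕ.^ 2 ℕ.+ m) ≡ M * M + M
    +μ≡ = trans (ℤₚ.pos-+ (m ℕ.^ 2) m) (cong (_+ M) +m²≡)

    +k≡ : + (2 ℕ.* m ℕ.^ 2 ℕ.+ m) ≡ M * M + M + M * M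
    +k≡ = trans (ℤₚ.pos-+ (2 ℕ.* m ℕ.^ 2) m) (trans (cong (_+ M) (trans (ℤₚ.pos-* 2 (m ℕ.^ 2)) (cong (+ 2 *_) +m²≡))) (regroup M))
      where
      regroup : ∀ M → + 2 * (M * M) + M ≡ M * M + M + M * M
      regroup = solve-∀

    +N≡ : + (2 ℕ.* (2 ℕ.* m ℕ.^ 2)) ≡ + 2 * (+ 2 * (M * M))
    +N≡ = trans (ℤₚ.pos-* 2 (2 ℕ.* m ℕ.^ 2)) (cong (+ 2 *_) (trans (ℤₚ.pos-* 2 (m ℕ.^ 2)) (cong (+ 2 *_) +m²≡)))

module _ (s : ℕ) where
  open import Data.Integer using (_+_; _*_; _-_; -_)

  private
    m : ℕ
    m = 3 ℕ.+ s

  open Parameters m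

  classes-nonempty : ∀ p q → profileCount (+ (2 ℕ.* (2 ℕ.* m ℕ.^ 2))) (+ (2 ℕ.* m ℕ.^ 2 ℕ.+ m)) (+ (m ℕ.^ 2 ℕ.+ m)) p q ≢ 0ℤ
  classes-nonempty p q rewrite +N≡ | +k≡ | +μ≡ = nonzero p q
    where
    difference : ∀ M → M * M + M + M * M - (M * M + M) ≡ M * M
    difference = solve-∀
    factorise : ∀ M → + 2 * (+ 2 * (M * M)) - (M * M + M + M * M) - (M * M + M + M * M) + (M * M + M) - + 2 ≡
                      (M - + 2) * (M + 1ℤ)
    factorise = solve-∀
    nonzero : ∀ p q → profileCount (+ 2 * (+ 2 * (M * M))) (M * M + M + M * M) (M * M + M) p q ≢ 0ℤ
    nonzero true  true  = λ ()
    nonzero true  false = λ count≡0 → case trans (sym (difference M)) count≡0 of λ ()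
    nonzero false true  = λ count≡0 → case trans (sym (difference M)) count≡0 of λ ()
    nonzero false false = λ count≡0 → case trans (sym (factorise M)) count≡0 of λ ()

  no-valencies : ¬ 2 ∣ m → ∀ c → ¬ (∀ p q → ValencyEquation (+ (2 ℕ.* m ℕ.^ 2 ℕ.+ m)) (+ (m ℕ.^ 2 ℕ.+ m)) c p q)
  no-valencies m-odd c equations =
    [ odd⇒2y-m[m+2]≢0 m m-odd (c false false) , [m²-m-1]y+m≢0 s _ ]′
      (valency-dichotomy M c (subst₂ (λ k μ → ∀ p q → ValencyEquation k μ c p q) +k≡ +μ≡ equations) (λ ()) (λ ()))

open import Data.Nat using (_+_; _*_; _^_; _≤_)

proposition5p3 : (m : ℕ) → 3 ≤ m → ¬ (2 ∣ m) →
  (G : Graph (2 * (2 * m ^ 2))) →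
  StronglyRegular G (2 * m ^ 2 + m) (m ^ 2 + m) (m ^ 2 + m) →
  (ρ : Permutation′ (2 * (2 * m ^ 2))) → IsAutomorphism G ρ → Semiregular2 (2 * m ^ 2) ρ →
  (u w : Fin (2 * (2 * m ^ 2))) → DistinctOrbits ρ u w →
  card-T (2 * m ^ 2) G ρ u w ≡ m ^ 2 →
  card-S (2 * m ^ 2) G ρ u ≡ m ^ 2 + m →
  card-S (2 * m ^ 2) G ρ w ≡ m ^ 2 + m →
  ∀ x → ¬ LocallyIsoregular3 G x
proposition5p3 (suc (suc (suc s))) (s≤s (s≤s (s≤s z≤n))) m-odd G srg _ _ _ _ _ _ _ _ _ x
               (_ , z , _ , _ , x≁z , _ , x≢z , isoregular) =
  let (c , equations) = NonadjacentPair.valency-equations G x≢z (¬-not x≁z) srg isoregular (classes-nonempty s)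
  in no-valencies s m-odd c equations
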